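{- Let $G$ be a finite simple graph. Then $G$ is a color-line graph if and only if there exists a family $\mathcal{Q}$ of cliques of $G$ such that (a) every vertex of $G$ belongs to at most three members of $\mathcal{Q}$, and every edge of $G$ belongs to at least one and at most two members of $\mathcal{Q}$; (b) letting $F\subseteq E(G)$ be the set of edges of $G$ belonging to exactly two members of $\mathcal{Q}$ and $W\subseteq V(G)$ the set of vertices of $G$ belonging to exactly three members of $\mathcal{Q}$, there exist mappings $F\to\mathcal{Q}$, $e\mapsto Q_e$, and $W\to\mathcal{Q}$, $v\mapsto Q_v$, such that (b1) for all $x\in F\cup W$, $x\in Q_x$, and (b2) for all $x,y\in F\cup W$: if $x\in Q_y$ then $Q_x=Q_y$, and if $x\notin Q_y$ then $Q_x\cap Q_y=\emptyset$.
   Context: All graphs are finite and simple. An edge coloring of a graph $H$ is a map $\phi:E(H)\to\mathcal{C}$ into a set of colors; it is proper if any two distinct edges sharing an endvertex get different colors. For an edge-colored graph $(H,\phi)$, the color-line graph $\mathrm{CL}(H)$ has vertex set $E(H)$, two distinct vertices being adjacent iff the corresponding edges of $H$ share an endvertex or have the same color. A graph $G$ is a color-line graph if it is isomorphic to $\mathrm{CL}(H)$ for some edge-colored graph $H$. A clique is a set of pairwise adjacent vertices. An edge $e=uv$ "belongs to" (or "is in") a clique $Q$ if $u,v\in Q$; a vertex belongs to $Q$ if it is an element of $Q$. For an edge $x$, "$x\in Q$" means both endpoints of $x$ lie in $Q$. -}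

module Defs where

open import Data.Nat using (ℕ; zero; suc; _+_; _≤_)
open import Data.Bool using (Bool; true; false; _∧_)
open import Data.Fin using (Fin; zero; suc; _<_)
open import Data.Fin.Subset using (Subset; _∈_)
open import Data.Vec using (lookup)
open import Data.Product using (Σ; Σ-syntax; ∃; ∃-syntax; _×_; _,_; proj₁; proj₂)
open import Data.Sum using (_⊎_)
open import Data.Empty using (⊥)
open import Relation.Nullary using (¬_)
open import Relation.Binary.PropositionalEquality using (_≡_; _≢_)
open import Function.Bundles using (_⤖_; _⇔_; Bijection)
open import Function.Definitions using (Injective)

record Graph (n : ℕ) : Set where
  field
    adj    : Fin n → Fin n → Bool
    sym    : ∀ u v → adj u v ≡ adj v u
    irrefl : ∀ u → adj u u ≡ false
open Graph public

-- An edge of G: an unordered pair {u,v} represented by u < v with u ~ v.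
Edge : ∀ {n} → Graph n → Set
Edge {n} G = Σ (Fin n × Fin n) λ p → (proj₁ p < proj₂ p) × (adj G (proj₁ p) (proj₂ p) ≡ true)

ShareEnd : ∀ {n} {G : Graph n} → Edge G → Edge G → Set
ShareEnd ((u , v) , _) ((u' , v') , _) = u ≡ u' ⊎ u ≡ v' ⊎ v ≡ u' ⊎ v ≡ v'

CLAdj : ∀ {m} (H : Graph m) {C : Set} (φ : Edge H → C) → Edge H → Edge H → Set
CLAdj H φ e e' = e ≢ e' × (ShareEnd {G = H} e e' ⊎ φ e ≡ φ e')

IsColorLineGraph : ∀ {n} → Graph n → Set₁
IsColorLineGraph {n} G =
  Σ ℕ λ m → Σ (Graph m) λ H → Σ Set λ C → Σ (Edge H → C) λ φ →
  Σ (Fin n ⤖ Edge H) λ f →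
    ∀ x y → (adj G x y ≡ true) ⇔ CLAdj H φ (Bijection.to f x) (Bijection.to f y)

IsClique : ∀ {n} → Graph n → Subset n → Set
IsClique G S = ∀ u v → u ∈ S → v ∈ S → u ≢ v → adj G u v ≡ true

countF : ∀ {k} → (Fin k → Bool) → ℕ
countF {zero}  p = 0
countF {suc k} p with p zero
... | true  = suc (countF (λ i → p (suc i)))
... | false = countF (λ i → p (suc i))

module _ {n k : ℕ} (Q : Fin k → Subset n) where

  vCount : Fin n → ℕ
  vCount v = countF (λ i → lookup (Q i) v)

  eCount : Fin n → Fin n → ℕ
  eCount u v = countF (λ i → lookup (Q i) u ∧ lookup (Q i) v)

  data FW (G : Graph n) : Set where
    edgeF : (u v : Fin n) → u < v → adj G u v ≡ true → eCount u v ≡ 2 → FW G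
    vertW : (w : Fin n) → vCount w ≡ 3 → FW G

  InQ : {G : Graph n} → FW G → Fin k → Set
  InQ (edgeF u v _ _ _) i = u ∈ Q i × v ∈ Q i
  InQ (vertW w _)       i = w ∈ Q i

  Disjoint : Fin k → Fin k → Set
  Disjoint i j = ∀ z → z ∈ Q i → z ∈ Q j → ⊥

-- Existence of a clique family Q of G satisfying (a) and (b) of the theorem.
-- The family is a set of cliques: Q : Fin k → Subset n injective.
HasCliqueFamily : ∀ {n} → Graph n → Set
HasCliqueFamily {n} G =
  Σ ℕ λ k → Σ (Fin k → Subset n) λ Q →
    Injective _≡_ _≡_ Q ×
    (∀ i → IsClique G (Q i)) ×
    (∀ v → vCount Q v ≤ 3) ×
    (∀ u v → adj G u v ≡ true → 1 ≤ eCount Q u v × eCount Q u v ≤ 2) ×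
    Σ (FW Q G → Fin k) λ q →
      (∀ x → InQ Q x (q x)) ×
      (∀ x y → (InQ Q x (q y) → q x ≡ q y) × (¬ InQ Q x (q y) → Disjoint Q (q x) (q y)))

-- In CL(H) the edges of H at a vertex form a clique (a star), and so do the edges of one colour.
-- Every edge of H lies in its two stars and its colour class, and two adjacent vertices of CL(H)
-- share their colour class or their unique common star.  So a vertex in three of these cliques,
-- or an edge in two, lies in a colour class; taking that class as Q_x gives (b), since colour
-- classes are disjoint.
-- Conversely, call the cliques Q_x colour cliques and the others stars.  By (b2) the colour
-- cliques are pairwise disjoint.  By (a) a vertex of G lies in at most two stars (a vertex in
-- three cliques lies in W, and one of them is Q_v), and two vertices share at most one star (an
-- edge in two cliques lies in F, and one of them is Q_e).  So H gets one vertex per star, each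
-- vertex of G becomes the edge of H between its stars (padded with private vertices), coloured
-- by its colour clique or by a private colour.
module Submission where

open import Defs hiding (sym)
open import Data.Nat using (ℕ; zero; suc; _+_; _≤_; z≤n; s≤s)
open import Data.Nat.Properties using (≤-trans; ≤-reflexive; ≤-antisym; m≤n⇒m≤1+n; ≡-irrelevant)
  renaming (_≟_ to _≟ⁿ_)
open import Data.Bool using (Bool; true; false; _∧_; not)
open import Data.Bool.Properties using (∧-identityʳ; ¬-not) renaming (_≟_ to _≟ᵇ_)
open import Data.Fin using (Fin; zero; suc; _<_; join; splitAt)
open import Data.Fin.Properties using (_≟_; _<?_; any?; <-cmp; <-asym; <⇒≢; <-irrelevant; splitAt-join)
open import Data.Fin.Subset using (Subset; _∈_)
open import Data.Fin.Subset.Properties using (_∈?_)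
open import Data.Vec using (lookup; tabulate)
open import Data.Vec.Properties using ([]=⇒lookup; lookup⇒[]=; lookup∘tabulate; ≡-dec)
open import Data.List using (List; []; _∷_; length; _++_; map; allFin; cartesianProduct; deduplicate)
import Data.List as List
open import Data.List.Membership.Propositional using () renaming (_∈_ to _∈ₗ_)
open import Data.List.Membership.Propositional.Properties
  using ( ∈-lookup; ∈-deduplicate⁻; ∈-deduplicate⁺; ∈-cartesianProduct⁺; ∈-allFin; ∈-map⁺; ∈-map⁻
        ; ∈-++⁺ˡ; ∈-++⁺ʳ; ∈-++⁻)
open import Data.List.Relation.Unary.Any using (here; there; index)
open import Data.List.Relation.Unary.Any.Properties using (lookup-index)
open import Data.List.Relation.Unary.All using (All; []; _∷_)
import Data.List.Relation.Unary.All as All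
open import Data.List.Relation.Unary.Unique.Propositional using (Unique; []; _∷_)
open import Data.List.Relation.Unary.Unique.DecPropositional.Properties using (deduplicate-!)
open import Data.Product using (Σ; ∃; _×_; _,_; proj₁; proj₂)
open import Data.Sum using (_⊎_; inj₁; inj₂; [_,_]′; reduce; map₂; swap) renaming (map to map⊎)
open import Data.Sum.Properties using (inj₁-injective; inj₂-injective)
open import Data.Empty using (⊥; ⊥-elim)
open import Function using (_∘_; id; flip; case_of_)
open import Function.Bundles using (_⇔_; mk⇔; _⤖_; mk⤖; Bijection; module Equivalence)
open import Function.Construct.Composition using (_⇔-∘_)
open import Function.Definitions using (Injective)
open import Function.Consequences.Propositional using (strictlySurjective⇒surjective)
open import Relation.Nullary using (¬_; Dec; yes; no; does; contradiction)
open import Relation.Nullary.Decidable using (dec-true; dec-false; does-⇔; map′; _×-dec_; _⊎-dec_; ¬?)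
open import Relation.Binary.Definitions using (DecidableEquality; Decidable; tri<; tri≈; tri>)
open import Relation.Binary.PropositionalEquality
  using (_≡_; _≢_; refl; sym; trans; cong; subst; module ≡-Reasoning)
import Axiom.UniquenessOfIdentityProofs as UIP

open Equivalence using (to; from)

join-injective : ∀ m n → Injective _≡_ _≡_ (join m n)
join-injective m n {i} {j} eq =
  trans (sym (splitAt-join m n i)) (trans (cong (splitAt m) eq) (splitAt-join m n j))

fibre? : ∀ {D B : Set} → Dec D → (f : D → B) → (∀ d d′ → f d ≡ f d′) →
         DecidableEquality B → ∀ b → Dec (∃ λ d → f d ≡ b)
fibre? (no ¬d) f _ _ b = no (¬d ∘ proj₁)
fibre? (yes d) f f-const _≟B_ b = map′ (d ,_) (λ (d′ , eq) → trans (f-const d d′) eq) (f d ≟B b)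

does⇒ : ∀ {a} {A : Set a} (a? : Dec A) → does a? ≡ true → A
does⇒ (yes a) _ = a

∧-≡-true : ∀ {a b} → a ∧ b ≡ true → a ≡ true × b ≡ true
∧-≡-true {true} {true} _ = refl , refl

lookup-injective : ∀ {A : Set} {xs : List A} → Unique xs → Injective _≡_ _≡_ (List.lookup xs)
lookup-injective {xs = _ ∷ _} (x∉ ∷ _) {zero} {zero} _ = refl
lookup-injective {xs = _ ∷ _} (x∉ ∷ _) {zero} {suc j} eq = contradiction eq (All.lookup x∉ (∈-lookup j))
lookup-injective {xs = _ ∷ _} (x∉ ∷ _) {suc i} {zero} eq = contradiction (sym eq) (All.lookup x∉ (∈-lookup i))
lookup-injective {xs = _ ∷ _} (_ ∷ u) {suc i} {suc j} eq = cong suc (lookup-injective u eq)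

record DistinctEnumeration {B : Set} (xs : List B) : Set where
  field
    size         : ℕ
    at           : Fin size → B
    at-injective : Injective _≡_ _≡_ at
    at-∈         : ∀ i → at i ∈ₗ xs
    ∈-at         : ∀ {b} → b ∈ₗ xs → ∃ λ i → at i ≡ b

enumerateDistinct : ∀ {B : Set} → DecidableEquality B → (xs : List B) → DistinctEnumeration xs
enumerateDistinct _≟B_ xs = record
  { size         = length ys
  ; at           = List.lookup ys
  ; at-injective = lookup-injective (deduplicate-! _≟B_ xs)
  ; at-∈         = λ i → ∈-deduplicate⁻ _≟B_ xs (∈-lookup i)
  ; ∈-at         = λ b∈xs → let b∈ys = ∈-deduplicate⁺ _≟B_ b∈xs in index b∈ys , sym (lookup-index b∈ys)
  }
  where ys = deduplicate _≟B_ xs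

∈-tabulate : ∀ {n} {P : Fin n → Set} (P? : ∀ x → Dec (P x)) {x} → x ∈ tabulate (does ∘ P?) ⇔ P x
∈-tabulate P? {x} = mk⇔
  (λ x∈ → does⇒ (P? x) (trans (sym (lookup∘tabulate _ x)) ([]=⇒lookup x∈)))
  (λ px → lookup⇒[]= x _ (trans (lookup∘tabulate _ x) (dec-true (P? x) px)))

_∖_ : ∀ {k} → (Fin k → Bool) → Fin k → Fin k → Bool
(p ∖ j) i = p i ∧ not (does (i ≟ j))

∖-true : ∀ {k} (p : Fin k → Bool) {i j} → p i ≡ true → i ≢ j → (p ∖ j) i ≡ true
∖-true p {i} {j} pi i≢j with i ≟ j
... | yes i≡j = contradiction i≡j i≢j
... | no _    = trans (∧-identityʳ _) pi

∖-sound : ∀ {k} (p : Fin k → Bool) {i j} → (p ∖ j) i ≡ true → p i ≡ true × i ≢ j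
∖-sound p {i} {j} _ with p i | i ≟ j
... | true | no i≢j = refl , i≢j

countF-cong : ∀ {k} {p q : Fin k → Bool} → (∀ i → p i ≡ q i) → countF p ≡ countF q
countF-cong {zero} _ = refl
countF-cong {suc k} {p} {q} p≗q rewrite p≗q zero with q zero
... | true  = cong suc (countF-cong (p≗q ∘ suc))
... | false = countF-cong (p≗q ∘ suc)

countF-≡0 : ∀ {k} (p : Fin k → Bool) → (∀ i → p i ≡ false) → countF p ≡ 0
countF-≡0 {zero}  _ _ = refl
countF-≡0 {suc k} p none rewrite none zero = countF-≡0 (p ∘ suc) (none ∘ suc)

countF-mono : ∀ {k} {p q : Fin k → Bool} → (∀ i → p i ≡ true → q i ≡ true) → countF p ≤ countF q
countF-mono {zero} _ = z≤n
countF-mono {suc k} {p} {q} p⇒q with p zero in pz | q zero in qz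
... | true  | true  = s≤s (countF-mono (p⇒q ∘ suc))
... | true  | false = case trans (sym (p⇒q zero pz)) qz of λ ()
... | false | true  = m≤n⇒m≤1+n (countF-mono (p⇒q ∘ suc))
... | false | false = countF-mono (p⇒q ∘ suc)

countF-remove : ∀ {k} (p : Fin k → Bool) {j} → p j ≡ true → countF p ≡ suc (countF (p ∖ j))
countF-remove {suc k} p {zero} pj rewrite pj = cong suc (countF-cong λ i → sym (∧-identityʳ (p (suc i))))
countF-remove {suc k} p {suc j} pj with p zero
... | true  = cong suc (countF-remove (p ∘ suc) pj)
... | false = countF-remove (p ∘ suc) pj

countF≤suc-countF∖ : ∀ {k} (p : Fin k → Bool) j → countF p ≤ suc (countF (p ∖ j))
countF≤suc-countF∖ p j with p j in pj
... | true  = ≤-reflexive (countF-remove p pj)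
... | false = m≤n⇒m≤1+n (countF-mono {p = p} {p ∖ j} λ i pi →
                ∖-true p pi λ { refl → case trans (sym pi) pj of λ () })

length≤countF : ∀ {k} {p : Fin k → Bool} {is} → Unique is → All (λ i → p i ≡ true) is → length is ≤ countF p
length≤countF [] [] = z≤n
length≤countF {p = p} (j≢is ∷ u) (pj ∷ ps) =
  ≤-trans (s≤s (length≤countF u (without j≢is ps))) (≤-reflexive (sym (countF-remove p pj)))
  where
  without : ∀ {j is} → All (j ≢_) is → All (λ i → p i ≡ true) is → All (λ i → (p ∖ j) i ≡ true) is
  without [] [] = []
  without (j≢i ∷ ne) (pi ∷ ps) = ∖-true p pi (j≢i ∘ sym) ∷ without ne ps

countF≤length : ∀ {k} {p : Fin k → Bool} is → (∀ i → p i ≡ true → i ∈ₗ is) → countF p ≤ length is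
countF≤length {p = p} [] p⊆ = ≤-reflexive (countF-≡0 p λ i → ¬-not λ pi → case p⊆ i pi of λ ())
countF≤length {p = p} (j ∷ is) p⊆ =
  ≤-trans (countF≤suc-countF∖ p j) (s≤s (countF≤length is λ i h → rest i (∖-sound p h)))
  where
  rest : ∀ i → p i ≡ true × i ≢ j → i ∈ₗ is
  rest i (pi , i≢j) with p⊆ i pi
  ... | here i≡j   = contradiction i≡j i≢j
  ... | there i∈is = i∈is

countF>0⇒∃ : ∀ {k} (p : Fin k → Bool) → 1 ≤ countF p → ∃ λ i → p i ≡ true
countF>0⇒∃ p count>0 with any? (λ i → p i ≟ᵇ true)
... | yes found = found
... | no none = case ≤-trans count>0 (countF≤length [] λ i pi → contradiction (i , pi) none) of λ ()

module _ {n k : ℕ} (Q : Fin k → Subset n) where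

  vCount≤length : ∀ {v} is → (∀ i → v ∈ Q i → i ∈ₗ is) → vCount Q v ≤ length is
  vCount≤length is ⊆is = countF≤length is λ i v∈ → ⊆is i (lookup⇒[]= _ (Q i) v∈)

  length≤vCount : ∀ {v is} → Unique is → All (λ i → v ∈ Q i) is → length is ≤ vCount Q v
  length≤vCount u v∈ = length≤countF u (All.map []=⇒lookup v∈)

  eCount≤length : ∀ {u v} is → (∀ i → u ∈ Q i → v ∈ Q i → i ∈ₗ is) → eCount Q u v ≤ length is
  eCount≤length {u} {v} is ⊆is = countF≤length is λ i uv∈ →
    let (u∈ , v∈) = ∧-≡-true uv∈ in ⊆is i (lookup⇒[]= u (Q i) u∈) (lookup⇒[]= v (Q i) v∈)

  length≤eCount : ∀ {u v is} → Unique is → All (λ i → u ∈ Q i × v ∈ Q i) is → length is ≤ eCount Q u v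
  length≤eCount u uv∈ = length≤countF u (All.map both uv∈)
    where
    both : ∀ {i u v} → u ∈ Q i × v ∈ Q i → (lookup (Q i) u ∧ lookup (Q i) v) ≡ true
    both (u∈ , v∈) rewrite []=⇒lookup u∈ | []=⇒lookup v∈ = refl

  shared-of-eCount : ∀ {u v} → 1 ≤ eCount Q u v → ∃ λ i → u ∈ Q i × v ∈ Q i
  shared-of-eCount {u} {v} count>0 with countF>0⇒∃ _ count>0
  ... | i , uv∈ = let (u∈ , v∈) = ∧-≡-true uv∈ in i , lookup⇒[]= u (Q i) u∈ , lookup⇒[]= v (Q i) v∈

adj⇒≢ : ∀ {n} (G : Graph n) {x y} → adj G x y ≡ true → x ≢ y
adj⇒≢ G {x} xy refl = case trans (sym xy) (irrefl G x) of λ ()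

adj⇔sharedClique : ∀ {n k} (G : Graph n) (Q : Fin k → Subset n) →
  (∀ i → IsClique G (Q i)) → (∀ u v → adj G u v ≡ true → 1 ≤ eCount Q u v) →
  ∀ x y → (adj G x y ≡ true) ⇔ (x ≢ y × ∃ λ i → x ∈ Q i × y ∈ Q i)
adj⇔sharedClique G Q cliques covered x y = mk⇔
  (λ xy → adj⇒≢ G xy , shared-of-eCount Q (covered x y xy))
  (λ (x≢y , i , x∈ , y∈) → cliques i x y x∈ y∈ x≢y)

module ComponentLabelling {A C : Set} (_≟A_ : DecidableEquality A)
  {R : A → A → Set} (R? : Decidable R) (g : A → C) (R⇒g≡ : ∀ {x y} → R x y → g x ≡ g y) where

  Sound : (A → A) → Set
  Sound l = ∀ {x y} → l x ≡ l y → g x ≡ g y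

  redirect : A → A → (A → A) → A → A
  redirect y z l t with R? y z | t ≟A l y
  ... | yes _ | yes _ = l z
  ... | _     | _     = t

  redirect-cases : ∀ y z l t → redirect y z l t ≡ t ⊎ (R y z × t ≡ l y × redirect y z l t ≡ l z)
  redirect-cases y z l t with R? y z | t ≟A l y
  ... | yes r | yes t≡ly = inj₂ (r , t≡ly , refl)
  ... | yes _ | no _     = inj₁ refl
  ... | no _  | _        = inj₁ refl

  merge : A × A → (A → A) → A → A
  merge (y , z) l = redirect y z l ∘ l

  merge-sound : ∀ p l → Sound l → Sound (merge p l)
  merge-sound (y , z) l sound {x₁} {x₂} eq
    with redirect-cases y z l (l x₁) | redirect-cases y z l (l x₂)
  ... | inj₁ same₁ | inj₁ same₂ = sound (trans (sym same₁) (trans eq same₂))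
  ... | inj₂ (r , x₁~y , _) | inj₂ (_ , x₂~y , _) = trans (sound x₁~y) (sym (sound x₂~y))
  ... | inj₂ (r , x₁~y , moved₁) | inj₁ same₂ =
        trans (sound x₁~y) (trans (R⇒g≡ r) (sound (trans (sym moved₁) (trans eq same₂))))
  ... | inj₁ same₁ | inj₂ (r , x₂~y , moved₂) =
        trans (sound (trans (sym same₁) (trans eq moved₂))) (trans (sym (R⇒g≡ r)) (sym (sound x₂~y)))

  redirect-source : ∀ y z l → R y z → redirect y z l (l y) ≡ l z
  redirect-source y z l r with R? y z | l y ≟A l y
  ... | yes _ | yes _    = refl
  ... | yes _ | no ly≢ly = contradiction refl ly≢ly
  ... | no ¬r | _        = contradiction r ¬r

  redirect-target : ∀ y z l → redirect y z l (l z) ≡ l z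
  redirect-target y z l with R? y z | l z ≟A l y
  ... | yes _ | yes _ = refl
  ... | yes _ | no _  = refl
  ... | no _  | _     = refl

  merge-joins : ∀ y z l → R y z → merge (y , z) l y ≡ merge (y , z) l z
  merge-joins y z l r = trans (redirect-source y z l r) (sym (redirect-target y z l))

  mergeAll : List (A × A) → (A → A) → A → A
  mergeAll []       l = l
  mergeAll (p ∷ ps) l = mergeAll ps (merge p l)

  mergeAll-sound : ∀ ps l → Sound l → Sound (mergeAll ps l)
  mergeAll-sound []       l sound = sound
  mergeAll-sound (p ∷ ps) l sound = mergeAll-sound ps (merge p l) (merge-sound p l sound)

  mergeAll-resp : ∀ ps l {x y} → l x ≡ l y → mergeAll ps l x ≡ mergeAll ps l y
  mergeAll-resp []            l eq = eq
  mergeAll-resp ((y , z) ∷ ps) l eq = mergeAll-resp ps (merge (y , z) l) (cong (redirect y z l) eq)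

  mergeAll-joins : ∀ ps l {y z} → (y , z) ∈ₗ ps → R y z → mergeAll ps l y ≡ mergeAll ps l z
  mergeAll-joins (_ ∷ ps) l (here refl) r = mergeAll-resp ps _ (merge-joins _ _ l r)
  mergeAll-joins (p ∷ ps) l (there yz∈) r = mergeAll-joins ps (merge p l) yz∈ r

  componentLabelling : (xs : List A) → (∀ x → x ∈ₗ xs) →
    Σ (A → A) λ lab → (∀ {x y} → R x y → lab x ≡ lab y) × Sound lab
  componentLabelling xs complete =
    mergeAll pairs id ,
    (λ {x} {y} → mergeAll-joins pairs id (∈-cartesianProduct⁺ (complete x) (complete y))) ,
    mergeAll-sound pairs id (cong g)
    where pairs = cartesianProduct xs xs

module Edges {m : ℕ} (H : Graph m) where

  IsEnd : Edge H → Fin m → Set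
  IsEnd ((u , v) , _) c = c ≡ u ⊎ c ≡ v

  isEnd? : ∀ e c → Dec (IsEnd e c)
  isEnd? ((u , v) , _) c = (c ≟ u) ⊎-dec (c ≟ v)

  Edge-≡ : (e e′ : Edge H) → proj₁ e ≡ proj₁ e′ → e ≡ e′
  Edge-≡ ((u , v) , u<v , uv) ((.u , .v) , u<v′ , uv′) refl
    with <-irrelevant u<v u<v′ | UIP.Decidable⇒UIP.≡-irrelevant _≟ᵇ_ uv uv′
  ... | refl | refl = refl

  ends-≡ : ∀ {a c} (e e′ : Edge H) → a ≢ c →
           IsEnd e a → IsEnd e c → IsEnd e′ a → IsEnd e′ c → e ≡ e′
  ends-≡ {a} {c} e@((u , v) , u<v , _) e′@((u′ , v′) , u′<v′ , _) a≢c a∈e c∈e a∈e′ c∈e′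
    with orient e a∈e c∈e | orient e′ a∈e′ c∈e′
    where
    orient : ∀ (e : Edge H) → IsEnd e a → IsEnd e c →
             (a ≡ proj₁ (proj₁ e) × c ≡ proj₂ (proj₁ e)) ⊎ (a ≡ proj₂ (proj₁ e) × c ≡ proj₁ (proj₁ e))
    orient _ (inj₁ a≡) (inj₂ c≡) = inj₁ (a≡ , c≡)
    orient _ (inj₂ a≡) (inj₁ c≡) = inj₂ (a≡ , c≡)
    orient _ (inj₁ a≡) (inj₁ c≡) = contradiction (trans a≡ (sym c≡)) a≢c
    orient _ (inj₂ a≡) (inj₂ c≡) = contradiction (trans a≡ (sym c≡)) a≢c
  ... | inj₁ (refl , refl) | inj₁ (refl , refl) = Edge-≡ e e′ refl
  ... | inj₂ (refl , refl) | inj₂ (refl , refl) = Edge-≡ e e′ refl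
  ... | inj₁ (refl , refl) | inj₂ (refl , refl) = contradiction u<v (<-asym u′<v′)
  ... | inj₂ (refl , refl) | inj₁ (refl , refl) = contradiction u<v (<-asym u′<v′)

  shareEnd⇔commonEnd : ∀ e e′ → ShareEnd {G = H} e e′ ⇔ (∃ λ c → IsEnd e c × IsEnd e′ c)
  shareEnd⇔commonEnd ((u , v) , _) ((u′ , v′) , _) = mk⇔ common share
    where
    common : u ≡ u′ ⊎ u ≡ v′ ⊎ v ≡ u′ ⊎ v ≡ v′ → ∃ λ c → (c ≡ u ⊎ c ≡ v) × (c ≡ u′ ⊎ c ≡ v′)
    common (inj₁ eq)               = u , inj₁ refl , inj₁ eq
    common (inj₂ (inj₁ eq))        = u , inj₁ refl , inj₂ eq
    common (inj₂ (inj₂ (inj₁ eq))) = v , inj₂ refl , inj₁ eq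
    common (inj₂ (inj₂ (inj₂ eq))) = v , inj₂ refl , inj₂ eq
    share : (∃ λ c → (c ≡ u ⊎ c ≡ v) × (c ≡ u′ ⊎ c ≡ v′)) → u ≡ u′ ⊎ u ≡ v′ ⊎ v ≡ u′ ⊎ v ≡ v′
    share (_ , inj₁ refl , inj₁ eq) = inj₁ eq
    share (_ , inj₁ refl , inj₂ eq) = inj₂ (inj₁ eq)
    share (_ , inj₂ refl , inj₁ eq) = inj₂ (inj₂ (inj₁ eq))
    share (_ , inj₂ refl , inj₂ eq) = inj₂ (inj₂ (inj₂ eq))

module PairGraph {n m : ℕ} (end₁ end₂ : Fin n → Fin m) (end₁≢end₂ : ∀ x → end₁ x ≢ end₂ x) where

  Joins : Fin n → Fin m → Fin m → Set
  Joins x a b = (a ≡ end₁ x × b ≡ end₂ x) ⊎ (a ≡ end₂ x × b ≡ end₁ x)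

  joins? : ∀ x a b → Dec (Joins x a b)
  joins? x a b = ((a ≟ end₁ x) ×-dec (b ≟ end₂ x)) ⊎-dec ((a ≟ end₂ x) ×-dec (b ≟ end₁ x))

  joins-sym : ∀ {x a b} → Joins x a b → Joins x b a
  joins-sym (inj₁ (a≡ , b≡)) = inj₂ (b≡ , a≡)
  joins-sym (inj₂ (a≡ , b≡)) = inj₁ (b≡ , a≡)

  joins-irrefl : ∀ {x a} → ¬ Joins x a a
  joins-irrefl {x} (inj₁ (a≡ , a≡′)) = end₁≢end₂ x (trans (sym a≡) a≡′)
  joins-irrefl {x} (inj₂ (a≡ , a≡′)) = end₁≢end₂ x (trans (sym a≡′) a≡)

  opaque
    graph : Graph m
    graph = record
      { adj    = λ a b → does (any? λ x → joins? x a b)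
      ; sym    = λ a b → does-⇔ (mk⇔ swapJoins swapJoins) (any? _) (any? _)
      ; irrefl = λ a → dec-false (any? λ x → joins? x a a) λ (_ , j) → joins-irrefl j
      }
      where
      swapJoins : ∀ {a b} → ∃ (λ x → Joins x a b) → ∃ (λ x → Joins x b a)
      swapJoins (x , j) = x , joins-sym j

    joined : ∀ x → adj graph (end₁ x) (end₂ x) ≡ true
    joined x = dec-true (any? _) (x , inj₁ (refl , refl))

    adj⇒joins : ∀ {a b} → adj graph a b ≡ true → ∃ λ x → Joins x a b
    adj⇒joins = does⇒ (any? _)

  open Edges graph

  opaque
    edgeAt : Fin n → Edge graph
    edgeAt x with <-cmp (end₁ x) (end₂ x)
    ... | tri< lt _ _ = (end₁ x , end₂ x) , lt , joined x
    ... | tri≈ _ eq _ = contradiction eq (end₁≢end₂ x)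
    ... | tri> _ _ gt = (end₂ x , end₁ x) , gt , trans (Graph.sym graph _ _) (joined x)

    isEnd-edgeAt : ∀ x c → IsEnd (edgeAt x) c ⇔ (c ≡ end₁ x ⊎ c ≡ end₂ x)
    isEnd-edgeAt x c with <-cmp (end₁ x) (end₂ x)
    ... | tri< _ _ _  = mk⇔ id id
    ... | tri≈ _ eq _ = contradiction eq (end₁≢end₂ x)
    ... | tri> _ _ _  = mk⇔ swap swap

  edgeAt-surjective : ∀ e → ∃ λ x → edgeAt x ≡ e
  edgeAt-surjective e@((a , b) , a<b , ab) with adj⇒joins ab
  ... | x , j = x , ends-≡ (edgeAt x) e (<⇒≢ a<b) (endOf (joins-sym j)) (endOf j) (inj₁ refl) (inj₂ refl)
    where
    endOf : ∀ {c d} → Joins x c d → IsEnd (edgeAt x) d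
    endOf j = from (isEnd-edgeAt x _) (swap (map⊎ proj₂ proj₂ j))

module FromCliqueFamily {n k : ℕ} (G : Graph n) (Q : Fin k → Subset n)
  (cliques : ∀ i → IsClique G (Q i))
  (vCount≤3 : ∀ v → vCount Q v ≤ 3)
  (eCount-bounds : ∀ u v → adj G u v ≡ true → 1 ≤ eCount Q u v × eCount Q u v ≤ 2)
  (q : FW Q G → Fin k)
  (in-q : ∀ x → InQ Q x (q x))
  (coherent : ∀ x y → (InQ Q x (q y) → q x ≡ q y) × (¬ InQ Q x (q y) → Disjoint Q (q x) (q y)))
  where

  IsColourClique : Fin k → Set
  IsColourClique i = ∃ λ x → q x ≡ i

  StarOf : Fin n → Fin k → Set
  StarOf x i = ¬ IsColourClique i × x ∈ Q i

  FEdge : Fin n → Fin n → Set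
  FEdge u v = u < v × adj G u v ≡ true × eCount Q u v ≡ 2

  fEdge : ∀ {u v} → FEdge u v → FW Q G
  fEdge {u} {v} (u<v , uv , two) = edgeF u v u<v uv two

  fEdge-irrelevant : ∀ {u v} (d d′ : FEdge u v) → q (fEdge d) ≡ q (fEdge d′)
  fEdge-irrelevant (u<v , uv , two) (u<v′ , uv′ , two′)
    rewrite <-irrelevant u<v u<v′ | UIP.Decidable⇒UIP.≡-irrelevant _≟ᵇ_ uv uv′ | ≡-irrelevant two two′
    = refl

  vertW-irrelevant : ∀ {w} (c c′ : vCount Q w ≡ 3) → q (vertW w c) ≡ q (vertW w c′)
  vertW-irrelevant c c′ rewrite ≡-irrelevant c c′ = refl

  colourClique? : ∀ i → Dec (IsColourClique i)
  colourClique? i = map′ fromAnchor toAnchor (any? vertexAnchor? ⊎-dec any? λ u → any? (edgeAnchor? u))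
    where
    Anchor : Set
    Anchor = (∃ λ w → ∃ λ c → q (vertW w c) ≡ i) ⊎ (∃ λ u → ∃ λ v → ∃ λ (d : FEdge u v) → q (fEdge d) ≡ i)
    vertexAnchor? : ∀ w → Dec (∃ λ c → q (vertW w c) ≡ i)
    vertexAnchor? w = fibre? (vCount Q w ≟ⁿ 3) (q ∘ vertW w) vertW-irrelevant _≟_ i
    edgeAnchor? : ∀ u v → Dec (∃ λ (d : FEdge u v) → q (fEdge d) ≡ i)
    edgeAnchor? u v = fibre? ((u <? v) ×-dec (adj G u v ≟ᵇ true) ×-dec (eCount Q u v ≟ⁿ 2))
                             (q ∘ fEdge) fEdge-irrelevant _≟_ i
    fromAnchor : Anchor → IsColourClique i
    fromAnchor (inj₁ (_ , _ , eq))     = _ , eq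
    fromAnchor (inj₂ (_ , _ , _ , eq)) = _ , eq
    toAnchor : IsColourClique i → Anchor
    toAnchor (vertW w c , eq)            = inj₁ (w , c , eq)
    toAnchor (edgeF u v u<v uv two , eq) = inj₂ (u , v , (u<v , uv , two) , eq)

  inQ? : ∀ (x : FW Q G) i → Dec (InQ Q x i)
  inQ? (edgeF u v _ _ _) i = (u ∈? Q i) ×-dec (v ∈? Q i)
  inQ? (vertW w _)       i = w ∈? Q i

  colourClique-unique : ∀ {v i j} → IsColourClique i → IsColourClique j → v ∈ Q i → v ∈ Q j → i ≡ j
  colourClique-unique {v} (x , refl) (y , refl) v∈ v∈′ with inQ? x (q y)
  ... | yes x∈ = proj₁ (coherent x y) x∈
  ... | no x∉  = ⊥-elim (proj₂ (coherent x y) x∉ v v∈ v∈′)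

  colour≢star : ∀ {i j} → IsColourClique i → ¬ IsColourClique j → i ≢ j
  colour≢star c ¬c refl = ¬c c

  noThreeStars : ∀ {x A B C} → StarOf x A → StarOf x B → StarOf x C → A ≢ B → A ≢ C → B ≢ C → ⊥
  noThreeStars {x} (¬cA , x∈A) (¬cB , x∈B) (¬cC , x∈C) A≢B A≢C B≢C =
    case ≤-trans four (vCount≤3 x) of λ { (s≤s (s≤s (s≤s ()))) }
    where
    three : 3 ≤ vCount Q x
    three = length≤vCount Q ((A≢B ∷ A≢C ∷ []) ∷ (B≢C ∷ []) ∷ [] ∷ []) (x∈A ∷ x∈B ∷ x∈C ∷ [])
    x∈W : FW Q G
    x∈W = vertW x (≤-antisym (vCount≤3 x) three)
    cJ : IsColourClique (q x∈W)
    cJ = x∈W , refl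
    four : 4 ≤ vCount Q x
    four = length≤vCount Q
      ((colour≢star cJ ¬cA ∷ colour≢star cJ ¬cB ∷ colour≢star cJ ¬cC ∷ []) ∷
       (A≢B ∷ A≢C ∷ []) ∷ (B≢C ∷ []) ∷ [] ∷ [])
      (in-q x∈W ∷ x∈A ∷ x∈B ∷ x∈C ∷ [])

  noTwoStarsOnEdge : ∀ {u v A B} → u < v → A ≢ B → StarOf u A → StarOf v A → StarOf u B → StarOf v B → ⊥
  noTwoStarsOnEdge {u} {v} u<v A≢B (¬cA , uA) (_ , vA) (¬cB , uB) (_ , vB) =
    case ≤-trans three (proj₂ (eCount-bounds u v uv)) of λ { (s≤s (s≤s ())) }
    where
    uv : adj G u v ≡ true
    uv = cliques _ u v uA vA (<⇒≢ u<v)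
    uv∈F : FW Q G
    uv∈F = edgeF u v u<v uv (≤-antisym (proj₂ (eCount-bounds u v uv))
                                      (length≤eCount Q ((A≢B ∷ []) ∷ [] ∷ []) ((uA , vA) ∷ (uB , vB) ∷ [])))
    cC : IsColourClique (q uv∈F)
    cC = uv∈F , refl
    three : 3 ≤ eCount Q u v
    three = length≤eCount Q
      ((A≢B ∷ (colour≢star cC ¬cA ∘ sym) ∷ []) ∷ ((colour≢star cC ¬cB ∘ sym) ∷ []) ∷ [] ∷ [])
      ((uA , vA) ∷ (uB , vB) ∷ in-q uv∈F ∷ [])

  sharedStar-unique : ∀ {x y A B} → x ≢ y → StarOf x A → StarOf y A → StarOf x B → StarOf y B → A ≡ B
  sharedStar-unique {x} {y} {A} {B} x≢y xA yA xB yB with A ≟ B | <-cmp x y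
  ... | yes A≡B | _            = A≡B
  ... | no A≢B  | tri< x<y _ _ = ⊥-elim (noTwoStarsOnEdge x<y A≢B xA yA xB yB)
  ... | no _    | tri≈ _ x≡y _ = contradiction x≡y x≢y
  ... | no A≢B  | tri> _ _ y<x = ⊥-elim (noTwoStarsOnEdge y<x A≢B yA xA yB xB)

  starOf? : ∀ x i → Dec (StarOf x i)
  starOf? x i = ¬? (colourClique? i) ×-dec (x ∈? Q i)

  -- Vertices of H: one per clique (only stars receive edges) and two private ones per vertex of G.
  V : Set
  V = Fin k ⊎ (Fin n ⊎ Fin n)

  OneOf : V → V → V → Set
  OneOf s₁ s₂ v = v ≡ s₁ ⊎ v ≡ s₂

  record Slots (x : Fin n) : Set where
    field
      slot₁ slot₂  : V
      slot₁≢slot₂  : slot₁ ≢ slot₂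
      star-slot    : ∀ {A} → OneOf slot₁ slot₂ (inj₁ A) → StarOf x A
      private-slot : ∀ {y} → OneOf slot₁ slot₂ (inj₂ y) → reduce y ≡ x
      star-covered : ∀ {A} → StarOf x A → OneOf slot₁ slot₂ (inj₁ A)

  opaque
    slots : ∀ x → Slots x
    slots x with any? (starOf? x)
    ... | no noStar = record
      { slot₁ = inj₂ (inj₁ x) ; slot₂ = inj₂ (inj₂ x) ; slot₁≢slot₂ = λ ()
      ; star-slot = λ { (inj₁ ()) ; (inj₂ ()) }
      ; private-slot = λ { (inj₁ refl) → refl ; (inj₂ refl) → refl }
      ; star-covered = λ sA → contradiction (_ , sA) noStar }
    ... | yes (A , sA) with any? (λ i → starOf? x i ×-dec ¬? (i ≟ A))
    ...   | yes (B , sB , B≢A) = record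
      { slot₁ = inj₁ A ; slot₂ = inj₁ B ; slot₁≢slot₂ = B≢A ∘ sym ∘ inj₁-injective
      ; star-slot = λ { (inj₁ refl) → sA ; (inj₂ refl) → sB }
      ; private-slot = λ { (inj₁ ()) ; (inj₂ ()) }
      ; star-covered = covered }
      where
      covered : ∀ {C} → StarOf x C → OneOf (inj₁ A) (inj₁ B) (inj₁ C)
      covered {C} sC with C ≟ A | C ≟ B
      ... | yes refl | _        = inj₁ refl
      ... | no _     | yes refl = inj₂ refl
      ... | no C≢A   | no C≢B   = ⊥-elim (noThreeStars sA sB sC (B≢A ∘ sym) (C≢A ∘ sym) (C≢B ∘ sym))
    ...   | no noOther = record
      { slot₁ = inj₁ A ; slot₂ = inj₂ (inj₁ x) ; slot₁≢slot₂ = λ ()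
      ; star-slot = λ { (inj₁ refl) → sA ; (inj₂ ()) }
      ; private-slot = λ { (inj₁ ()) ; (inj₂ refl) → refl }
      ; star-covered = covered }
      where
      covered : ∀ {C} → StarOf x C → OneOf (inj₁ A) (inj₂ (inj₁ x)) (inj₁ C)
      covered {C} sC with C ≟ A
      ... | yes refl = inj₁ refl
      ... | no C≢A   = contradiction (C , sC , C≢A) noOther

  open Slots

  Slot : Fin n → V → Set
  Slot x = OneOf (slot₁ (slots x)) (slot₂ (slots x))

  commonSlot : ∀ {x y v} → Slot x v → Slot y v → x ≡ y ⊎ ∃ λ A → v ≡ inj₁ A × StarOf x A × StarOf y A
  commonSlot {x} {y} {inj₁ A} sx sy = inj₂ (A , refl , star-slot (slots x) sx , star-slot (slots y) sy)
  commonSlot {x} {y} {inj₂ _} sx sy =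
    inj₁ (trans (sym (private-slot (slots x) sx)) (private-slot (slots y) sy))

  encode : V → Fin (k + (n + n))
  encode = join k (n + n) ∘ map₂ (join n n)

  encode-injective : Injective _≡_ _≡_ encode
  encode-injective {v} {w} eq with join-injective k (n + n) {map₂ (join n n) v} {map₂ (join n n) w} eq
  encode-injective {inj₁ _} {inj₁ _} _ | refl = refl
  encode-injective {inj₂ y} {inj₂ z} _ | eq′  = cong inj₂ (join-injective n n {y} {z} (inj₂-injective eq′))

  open PairGraph (encode ∘ slot₁ ∘ slots) (encode ∘ slot₂ ∘ slots)
                 (λ x → slot₁≢slot₂ (slots x) ∘ encode-injective)
  open Edges graph

  slot⇒end : ∀ {x v} → Slot x v → IsEnd (edgeAt x) (encode v)
  slot⇒end {x} s = from (isEnd-edgeAt x _) (map⊎ (cong encode) (cong encode) s)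

  end⇒slot : ∀ {x c} → IsEnd (edgeAt x) c → ∃ λ v → c ≡ encode v × Slot x v
  end⇒slot {x} c∈ with to (isEnd-edgeAt x _) c∈
  ... | inj₁ c≡ = _ , c≡ , inj₁ refl
  ... | inj₂ c≡ = _ , c≡ , inj₂ refl

  encodedEnd-slot : ∀ {x v} → IsEnd (edgeAt x) (encode v) → Slot x v
  encodedEnd-slot {x} v∈ with end⇒slot v∈
  ... | _ , eq , s = subst (Slot x) (sym (encode-injective eq)) s

  shareEnd⇒commonSlot : ∀ {x y} → ShareEnd {G = graph} (edgeAt x) (edgeAt y) → ∃ λ v → Slot x v × Slot y v
  shareEnd⇒commonSlot {x} {y} share =
    let (c , cx , cy) = to (shareEnd⇔commonEnd (edgeAt x) (edgeAt y)) share
        (v , c≡v , sx) = end⇒slot cx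
    in v , sx , encodedEnd-slot (subst (IsEnd (edgeAt y)) c≡v cy)

  edgeAt-injective : Injective _≡_ _≡_ edgeAt
  edgeAt-injective {x} {y} eq with x ≟ y
  ... | yes x≡y = x≡y
  ... | no x≢y with commonSlot (inj₁ refl) (moved (inj₁ refl)) | commonSlot (inj₂ refl) (moved (inj₂ refl))
    where
    moved : ∀ {v} → Slot x v → Slot y v
    moved s = encodedEnd-slot (subst (λ e → IsEnd e _) eq (slot⇒end s))
  ...   | inj₁ x≡y | _ = x≡y
  ...   | _ | inj₁ x≡y = x≡y
  ...   | inj₂ (A , s₁≡A , xA , yA) | inj₂ (B , s₂≡B , xB , yB) =
          contradiction (trans s₁≡A (trans (cong inj₁ (sharedStar-unique x≢y xA yA xB yB)) (sym s₂≡B)))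
                        (slot₁≢slot₂ (slots x))

  colourOf? : ∀ x i → Dec (IsColourClique i × x ∈ Q i)
  colourOf? x i = colourClique? i ×-dec (x ∈? Q i)

  opaque
    colour : Fin n → Fin k ⊎ Fin n
    colour x with any? (colourOf? x)
    ... | yes (i , _) = inj₁ i
    ... | no _        = inj₂ x

    colour-of-clique : ∀ {x i} → IsColourClique i → x ∈ Q i → colour x ≡ inj₁ i
    colour-of-clique {x} c x∈ with any? (colourOf? x)
    ... | yes (j , cj , x∈j) = cong inj₁ (colourClique-unique cj c x∈j x∈)
    ... | no none            = contradiction (_ , c , x∈) none

    colour-≡ : ∀ {x y} → colour x ≡ colour y → x ≡ y ⊎ ∃ λ i → x ∈ Q i × y ∈ Q i
    colour-≡ {x} {y} eq with any? (colourOf? x) | any? (colourOf? y)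
    ... | yes (i , _ , x∈) | yes (_ , _ , y∈) =
          inj₂ (i , x∈ , subst (λ j → y ∈ Q j) (sym (inj₁-injective eq)) y∈)
    ... | no _ | no _ = inj₁ (inj₂-injective eq)

  φ : Edge graph → Fin k ⊎ Fin n
  φ e = colour (proj₁ (edgeAt-surjective e))

  φ-edgeAt : ∀ x → φ (edgeAt x) ≡ colour x
  φ-edgeAt x = cong colour (edgeAt-injective (proj₂ (edgeAt-surjective (edgeAt x))))

  sharedClique⇔clAdj : ∀ x y → (x ≢ y × ∃ λ i → x ∈ Q i × y ∈ Q i) ⇔ CLAdj graph φ (edgeAt x) (edgeAt y)
  sharedClique⇔clAdj x y = mk⇔ toCL fromCL
    where
    open ≡-Reasoning
    toCL : (x ≢ y × ∃ λ i → x ∈ Q i × y ∈ Q i) → CLAdj graph φ (edgeAt x) (edgeAt y)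
    toCL (x≢y , i , x∈ , y∈) with colourClique? i
    ... | yes c = x≢y ∘ edgeAt-injective , inj₂ (begin
          φ (edgeAt x) ≡⟨ φ-edgeAt x ⟩
          colour x     ≡⟨ colour-of-clique c x∈ ⟩
          inj₁ i       ≡⟨ colour-of-clique c y∈ ⟨
          colour y     ≡⟨ φ-edgeAt y ⟨
          φ (edgeAt y) ∎)
    ... | no ¬c = x≢y ∘ edgeAt-injective , inj₁ (from (shareEnd⇔commonEnd (edgeAt x) (edgeAt y))
          (_ , slot⇒end (star-covered (slots x) (¬c , x∈)) , slot⇒end (star-covered (slots y) (¬c , y∈))))
    fromCL : CLAdj graph φ (edgeAt x) (edgeAt y) → x ≢ y × ∃ λ i → x ∈ Q i × y ∈ Q i
    fromCL (e≢ , inj₁ share) =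
      let (v , sx , sy) = shareEnd⇒commonSlot share in
      x≢y , [ flip contradiction x≢y , (λ (A , _ , (_ , x∈) , (_ , y∈)) → A , x∈ , y∈) ]′ (commonSlot sx sy)
      where x≢y = e≢ ∘ cong edgeAt
    fromCL (e≢ , inj₂ φ≡) =
      x≢y , [ flip contradiction x≢y , id ]′ (colour-≡ (trans (sym (φ-edgeAt x)) (trans φ≡ (φ-edgeAt y))))
      where x≢y = e≢ ∘ cong edgeAt

  isColorLineGraph : IsColorLineGraph G
  isColorLineGraph =
    _ , graph , (Fin k ⊎ Fin n) , φ ,
    mk⤖ (edgeAt-injective , strictlySurjective⇒surjective edgeAt-surjective) ,
    λ x y → sharedClique⇔clAdj x y ⇔-∘ adj⇔sharedClique G Q cliques (λ u v → proj₁ ∘ eCount-bounds u v) x y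

module ToCliqueFamily {n m : ℕ} (G : Graph n) (H : Graph m) {C : Set} (φ : Edge H → C) (f : Fin n ⤖ Edge H)
  (adj⇔ : ∀ x y → (adj G x y ≡ true) ⇔ CLAdj H φ (Bijection.to f x) (Bijection.to f y)) where

  open Edges H

  e : Fin n → Edge H
  e = Bijection.to f

  e≢ : ∀ {x y} → x ≢ y → e x ≢ e y
  e≢ x≢y = x≢y ∘ Bijection.injective f

  share? : ∀ a b → Dec (ShareEnd {G = H} a b)
  share? a b = map′ (from (shareEnd⇔commonEnd a b)) (to (shareEnd⇔commonEnd a b))
                    (any? λ c → isEnd? a c ×-dec isEnd? b c)

  ColourOnly : Fin n → Fin n → Set
  ColourOnly x y = adj G x y ≡ true × ¬ ShareEnd {G = H} (e x) (e y)

  colourOnly⇒sameColour : ∀ {x y} → ColourOnly x y → φ (e x) ≡ φ (e y)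
  colourOnly⇒sameColour {x} {y} (xy , ¬share) with proj₂ (to (adj⇔ x y) xy)
  ... | inj₁ share = contradiction share ¬share
  ... | inj₂ same  = same

  -- Colours need not have decidable equality, so colour classes are replaced by the classes
  -- generated by ColourOnly: they still force equal colours, and every edge of G outside all
  -- stars lies inside one of them.
  open ComponentLabelling _≟_ (λ x y → (adj G x y ≟ᵇ true) ×-dec ¬? (share? (e x) (e y)))
                          (φ ∘ e) colourOnly⇒sameColour using (componentLabelling)

  lab : Fin n → Fin n
  lab = proj₁ (componentLabelling (allFin n) ∈-allFin)

  lab-joins : ∀ {x y} → ColourOnly x y → lab x ≡ lab y
  lab-joins = proj₁ (proj₂ (componentLabelling (allFin n) ∈-allFin))

  lab-sound : ∀ {x y} → lab x ≡ lab y → φ (e x) ≡ φ (e y)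
  lab-sound = proj₂ (proj₂ (componentLabelling (allFin n) ∈-allFin))

  star : Fin m → Subset n
  star a = tabulate (does ∘ λ x → isEnd? (e x) a)

  class : Fin n → Subset n
  class l = tabulate (does ∘ λ x → lab x ≟ l)

  stars : List (Subset n)
  stars = map star (allFin m)

  open DistinctEnumeration (enumerateDistinct (≡-dec _≟ᵇ_) (stars ++ map class (allFin n)))
    renaming (size to k; at to Q; at-injective to Q-injective)

  opaque
    starIndex : Fin m → Fin k
    starIndex a = proj₁ (∈-at (∈-++⁺ˡ (∈-map⁺ star (∈-allFin a))))

    Q-starIndex : ∀ a → Q (starIndex a) ≡ star a
    Q-starIndex a = proj₂ (∈-at (∈-++⁺ˡ (∈-map⁺ star (∈-allFin a))))

    classIndex : Fin n → Fin k
    classIndex l = proj₁ (∈-at (∈-++⁺ʳ stars (∈-map⁺ class (∈-allFin l))))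

    Q-classIndex : ∀ l → Q (classIndex l) ≡ class l
    Q-classIndex l = proj₂ (∈-at (∈-++⁺ʳ stars (∈-map⁺ class (∈-allFin l))))

  ∈-star : ∀ {x a} → x ∈ Q (starIndex a) ⇔ IsEnd (e x) a
  ∈-star {a = a} rewrite Q-starIndex a = ∈-tabulate λ x → isEnd? (e x) a

  ∈-class : ∀ {x l} → x ∈ Q (classIndex l) ⇔ lab x ≡ l
  ∈-class {l = l} rewrite Q-classIndex l = ∈-tabulate λ x → lab x ≟ l

  Q-cases : ∀ i → (∃ λ a → i ≡ starIndex a) ⊎ (∃ λ l → i ≡ classIndex l)
  Q-cases i with ∈-++⁻ stars (at-∈ i)
  ... | inj₁ i∈stars   = let (a , _ , eq) = ∈-map⁻ star i∈stars in
                         inj₁ (a , Q-injective (trans eq (sym (Q-starIndex a))))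
  ... | inj₂ i∈classes = let (l , _ , eq) = ∈-map⁻ class i∈classes in
                         inj₂ (l , Q-injective (trans eq (sym (Q-classIndex l))))

  Q-clique : ∀ i → IsClique G (Q i)
  Q-clique i x y x∈ y∈ x≢y with Q-cases i
  ... | inj₁ (a , refl) = from (adj⇔ x y)
        (e≢ x≢y , inj₁ (from (shareEnd⇔commonEnd (e x) (e y))
                          (a , to ∈-star x∈ , to ∈-star y∈)))
  ... | inj₂ (l , refl) = from (adj⇔ x y)
        (e≢ x≢y , inj₂ (lab-sound (trans (to ∈-class x∈) (sym (to ∈-class y∈)))))

  Q-vCount≤3 : ∀ x → vCount Q x ≤ 3
  Q-vCount≤3 x = vCount≤length Q (starIndex u ∷ starIndex v ∷ classIndex (lab x) ∷ []) listed
    where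
    u v : Fin m
    u = proj₁ (proj₁ (e x))
    v = proj₂ (proj₁ (e x))
    listed : ∀ i → x ∈ Q i → i ∈ₗ starIndex u ∷ starIndex v ∷ classIndex (lab x) ∷ []
    listed i x∈ with Q-cases i
    ... | inj₂ (l , refl) rewrite to ∈-class x∈ = there (there (here refl))
    ... | inj₁ (a , refl) with to ∈-star x∈
    ...   | inj₁ refl = here refl
    ...   | inj₂ refl = there (here refl)

  sharedCliques : ∀ {x y c i} → adj G x y ≡ true → IsEnd (e x) c → IsEnd (e y) c →
                  x ∈ Q i → y ∈ Q i → i ≡ starIndex c ⊎ (i ≡ classIndex (lab x) × lab x ≡ lab y)
  sharedCliques {x} {y} {c} {i} xy cx cy x∈ y∈ with Q-cases i
  ... | inj₂ (l , refl) = inj₂ (cong classIndex (sym lx≡l) , trans lx≡l (sym (to ∈-class y∈)))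
    where lx≡l = to ∈-class x∈
  ... | inj₁ (a , refl) with a ≟ c
  ...   | yes refl = inj₁ refl
  ...   | no a≢c = contradiction (ends-≡ (e x) (e y) a≢c (to ∈-star x∈) cx (to ∈-star y∈) cy)
                                 (e≢ (adj⇒≢ G xy))

  nonSharedCliques : ∀ {x y i} → ¬ ShareEnd {G = H} (e x) (e y) → x ∈ Q i → y ∈ Q i → i ≡ classIndex (lab x)
  nonSharedCliques {x} {y} {i} ¬share x∈ y∈ with Q-cases i
  ... | inj₁ (a , refl) = contradiction (from (shareEnd⇔commonEnd (e x) (e y))
                            (a , to ∈-star x∈ , to ∈-star y∈)) ¬share
  ... | inj₂ (l , refl) = cong classIndex (sym (to ∈-class x∈))

  Q-eCount-bounds : ∀ x y → adj G x y ≡ true → 1 ≤ eCount Q x y × eCount Q x y ≤ 2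
  Q-eCount-bounds x y xy with share? (e x) (e y)
  ... | yes share =
        let (c , cx , cy) = to (shareEnd⇔commonEnd (e x) (e y)) share in
        length≤eCount Q ([] ∷ []) ((from ∈-star cx , from ∈-star cy) ∷ []) ,
        eCount≤length Q (starIndex c ∷ classIndex (lab x) ∷ []) λ i x∈ y∈ →
          case sharedCliques xy cx cy x∈ y∈ of λ where
            (inj₁ refl)       → here refl
            (inj₂ (refl , _)) → there (here refl)
  ... | no ¬share =
        length≤eCount Q ([] ∷ []) ((from ∈-class refl ,
                                    from ∈-class (sym (lab-joins (xy , ¬share)))) ∷ []) ,
        ≤-trans (eCount≤length Q (classIndex (lab x) ∷ []) λ i x∈ y∈ → here (nonSharedCliques ¬share x∈ y∈))
                (s≤s z≤n)

  lab-of-doubleEdge : ∀ {x y} → adj G x y ≡ true → eCount Q x y ≡ 2 → lab x ≡ lab y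
  lab-of-doubleEdge {x} {y} xy two with lab x ≟ lab y | share? (e x) (e y)
  ... | yes same | _           = same
  ... | no _     | no ¬share   = lab-joins (xy , ¬share)
  ... | no lab≢  | yes share   =
        let (c , cx , cy) = to (shareEnd⇔commonEnd (e x) (e y)) share in
        case ≤-trans (≤-reflexive (sym two)) (eCount≤length Q (starIndex c ∷ []) λ i x∈ y∈ →
               case sharedCliques xy cx cy x∈ y∈ of λ where
                 (inj₁ refl)         → here refl
                 (inj₂ (_ , lab≡))   → contradiction lab≡ lab≢)
        of λ { (s≤s ()) }

  labFW : FW Q G → Fin n
  labFW (edgeF u _ _ _ _) = lab u
  labFW (vertW w _)       = lab w

  q : FW Q G → Fin k
  q = classIndex ∘ labFW

  inQ-class : ∀ x {l} → InQ Q x (classIndex l) ⇔ labFW x ≡ l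
  inQ-class (edgeF u v _ uv two) = mk⇔ (to ∈-class ∘ proj₁) λ lu≡l →
    from ∈-class lu≡l , from ∈-class (trans (sym (lab-of-doubleEdge uv two)) lu≡l)
  inQ-class (vertW w _) = ∈-class

  q-in : ∀ x → InQ Q x (q x)
  q-in x = from (inQ-class x) refl

  q-coherent : ∀ x y → (InQ Q x (q y) → q x ≡ q y) × (¬ InQ Q x (q y) → Disjoint Q (q x) (q y))
  q-coherent x y =
    cong classIndex ∘ to (inQ-class x) ,
    λ x∉ z z∈x z∈y → x∉ (from (inQ-class x) (trans (sym (to ∈-class z∈x)) (to ∈-class z∈y)))

  hasCliqueFamily : HasCliqueFamily G
  hasCliqueFamily = k , Q , Q-injective , Q-clique , Q-vCount≤3 , Q-eCount-bounds , q , q-in , q-coherent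

theorem3 : ∀ {n : ℕ} (G : Graph n) → IsColorLineGraph G ⇔ HasCliqueFamily G
theorem3 G = mk⇔
  (λ (_ , H , _ , φ , f , adj⇔) → ToCliqueFamily.hasCliqueFamily G H φ f adj⇔)
  (λ (_ , Q , _ , cliques , vCount≤3 , eCount-bounds , q , in-q , coherent) →
     FromCliqueFamily.isColorLineGraph G Q cliques vCount≤3 eCount-bounds q in-q coherent)
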